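{- Let $n \geq 2$, let $M$ be a free $\mathbb{Z}$-module of rank $n$, and let $\mathcal{S} \subset M$ be a set satisfying: (1) $0 \notin \mathcal{S}$; (2) $x \in \mathcal{S} \Rightarrow -x \in \mathcal{S}$; (3) $\mathcal{S}$ has rank $n$; (4) $|\mathcal{S}| \geq n(n+1)$; (5) any $n$ linearly independent elements of $\mathcal{S}$ generate $M$. Let $e_1, \ldots, e_n \in \mathcal{S}$ be linearly independent elements such that $e_1 - e_i \in \mathcal{S}$ for all $2 \leq i \leq n$ (so $(e_1,\ldots,e_n)$ is a basis of $M$). Then every element of $\mathcal{S}$ other than $\pm e_1, \ldots, \pm e_n$ and $\pm(e_1 - e_i)$ ($2 \leq i \leq n$) is of the form $\pm(e_i - e_j)$ or $\pm(e_1 - e_i - e_j)$ for some $2 \leq i < j \leq n$. Moreover, for each index pair $(i,j)$ with $2 \leq i < j \leq n$, exactly one of the pairs $\pm(e_i - e_j)$ and $\pm(e_1 - e_i - e_j)$ is contained in $\mathcal{S}$. -}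

module Defs where

open import Data.Nat using (ℕ; zero; suc; _≤_)
open import Data.Integer using (ℤ; 0ℤ) renaming (_+_ to _+ℤ_; _*_ to _*ℤ_; -_ to -ℤ_)
open import Data.Fin using (Fin; zero; suc)
open import Data.Vec using (Vec; zipWith; map; replicate)
open import Data.Product using (Σ; ∃; _×_)
open import Relation.Binary.PropositionalEquality using (_≡_)
open import Function.Definitions using (Injective)

M : ℕ → Set
M n = Vec ℤ n

infixl 6 _+ᵥ_ _-ᵥ_
infix 8 -ᵥ_

_+ᵥ_ : ∀ {n} → M n → M n → M n
_+ᵥ_ = zipWith _+ℤ_

-ᵥ_ : ∀ {n} → M n → M n
-ᵥ_ = map -ℤ_

_-ᵥ_ : ∀ {n} → M n → M n → M n
x -ᵥ y = x +ᵥ (-ᵥ y)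

_·ᵥ_ : ∀ {n} → ℤ → M n → M n
c ·ᵥ x = map (c *ℤ_) x

0ᵥ : ∀ {n} → M n
0ᵥ = replicate _ 0ℤ

lincomb : ∀ {n k} → (Fin k → ℤ) → (Fin k → M n) → M n
lincomb {k = zero}  c v = 0ᵥ
lincomb {k = suc k} c v = (c zero ·ᵥ v zero) +ᵥ lincomb (λ i → c (suc i)) (λ i → v (suc i))

LinIndep : ∀ {n k} → (Fin k → M n) → Set
LinIndep v = ∀ c → lincomb c v ≡ 0ᵥ → ∀ i → c i ≡ 0ℤ

Generates : ∀ {n k} → (Fin k → M n) → Set
Generates {n} v = ∀ (m : M n) → ∃ λ c → lincomb c v ≡ m

Subset : ℕ → Set₁
Subset n = M n → Set

HasFullRank : ∀ {n} → Subset n → Set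
HasFullRank {n} S = Σ (Fin n → M n) λ v → (∀ i → S (v i)) × LinIndep v

CardGE : ∀ {n} → Subset n → ℕ → Set
CardGE {n} S k = Σ (Fin k → M n) λ f → Injective _≡_ _≡_ f × (∀ i → S (f i))

-- the first index (e₁ in the paper's 1-based numbering)
first : ∀ {n} → 2 ≤ n → Fin n
first {suc n} _ = zero

{-# OPTIONS --safe #-}
-- Write elements of M in coordinates with respect to e. If B is a basis of M contained in S and x ∈ S has
-- a coefficient b_k ∉ {0, ±1} on B_k, replacing B_k by x gives another independent family in S, which
-- generates M by (5); writing B_k in it yields b_k d = 1, a contradiction. Pivoting, i.e. replacing e_i by
-- e_1 - e_i, preserves the hypotheses on e and turns the e_1-coefficient a_1 of x into a_1 + a_i, so the
-- sums a_1 + a_i, a_1 + a_i + a_j and a_1 + a_i + a_j + a_l lie in {0, ±1} as well; these constraints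
-- leave only the listed elements. In the basis where e_j is replaced by e_i - e_j, the element
-- e_1 - e_i - e_j has coefficient -2, so e_i - e_j and e_1 - e_i - e_j are never both in S.
-- With e_0 := 0 the listed elements are the e_p - e_q (0 ≤ p ≠ q ≤ n) and the ±(e_1 - e_i - e_j);
-- giving ±(e_1 - e_i - e_j) the pair of ±(e_i - e_j) assigns distinct ordered pairs to distinct elements
-- of S. As there are n(n+1) ≤ |S| such pairs, every pair is taken, in particular each (i, j).
module Submission where

open import Defs
open import Data.Nat using (ℕ; zero; suc; _≤_; _<_; z≤n; s≤s)
import Data.Nat as ℕ
open import Data.Fin as Fin using (Fin; zero; suc; toℕ; combine; punchOut) renaming (_<_ to _<ᶠ_)
open import Data.Fin.Properties
  using (suc-injective; any?; <-cmp; <⇒≢; <-asym; combine-injective; punchOut-injective; <⇒notInjective)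
open import Data.Product using (Σ; ∃; ∃-syntax; _×_; _,_; proj₁; proj₂)
open import Data.Sum using (_⊎_; inj₁; inj₂)
open import Data.Unit using (tt)
open import Data.Empty using (⊥; ⊥-elim)
open import Data.Vec using ([]; _∷_)
open import Data.Vec.Properties
  using (zipWith-assoc; zipWith-comm; zipWith-identityˡ; zipWith-inverseʳ; map-cong; map-∘)
open import Data.Vec.Functional using (updateAt)
open import Data.Vec.Functional.Properties using (updateAt-updates; updateAt-minimal)
open import Function using (_∘_; const)
open import Function.Definitions using (Injective)
open import Relation.Nullary using (¬_; yes; no; ¬?)
open import Relation.Nullary.Decidable using (_×-dec_)
open import Relation.Unary using (Decidable)
open import Relation.Binary using (tri<; tri≈; tri>)
open import Relation.Binary.PropositionalEquality
  using (_≡_; _≢_; _≗_; refl; sym; trans; cong; cong₂; subst; module ≡-Reasoning)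

-- ℤ arithmetic is opened only inside this module: the statement at the end uses ℕ's _+_ and _*_.
module _ where

  open import Data.Integer using (ℤ; +[1+_]; -[1+_]; 0ℤ; 1ℤ; -1ℤ; ∣_∣; _+_; _*_; -_; _-_)
  import Data.Integer.Properties as ℤ
  import Data.Nat.Properties as ℕₚ
  open import Data.Integer.Tactic.RingSolver using (solve-∀)
  open import Algebra.Properties.CommutativeSemigroup ℤ.+-commutativeSemigroup using (interchange)

  +ᵥ-assoc : ∀ {n} (x y z : M n) → x +ᵥ y +ᵥ z ≡ x +ᵥ (y +ᵥ z)
  +ᵥ-assoc = zipWith-assoc ℤ.+-assoc

  +ᵥ-comm : ∀ {n} (x y : M n) → x +ᵥ y ≡ y +ᵥ x
  +ᵥ-comm = zipWith-comm ℤ.+-comm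

  +ᵥ-identityˡ : ∀ {n} (x : M n) → 0ᵥ +ᵥ x ≡ x
  +ᵥ-identityˡ = zipWith-identityˡ ℤ.+-identityˡ

  +ᵥ-inverseʳ : ∀ {n} (x : M n) → x -ᵥ x ≡ 0ᵥ
  +ᵥ-inverseʳ = zipWith-inverseʳ ℤ.+-inverseʳ

  +ᵥ-interchange : ∀ {n} (x y z w : M n) → (x +ᵥ y) +ᵥ (z +ᵥ w) ≡ (x +ᵥ z) +ᵥ (y +ᵥ w)
  +ᵥ-interchange [] [] [] [] = refl
  +ᵥ-interchange (a ∷ x) (b ∷ y) (c ∷ z) (d ∷ w) =
    cong₂ _∷_ (interchange a b c d) (+ᵥ-interchange x y z w)

  ·ᵥ-distribˡ : ∀ {n} c (x y : M n) → c ·ᵥ (x +ᵥ y) ≡ c ·ᵥ x +ᵥ c ·ᵥ y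
  ·ᵥ-distribˡ c [] [] = refl
  ·ᵥ-distribˡ c (a ∷ x) (b ∷ y) = cong₂ _∷_ (ℤ.*-distribˡ-+ c a b) (·ᵥ-distribˡ c x y)

  ·ᵥ-distribʳ : ∀ {n} c d (x : M n) → (c + d) ·ᵥ x ≡ c ·ᵥ x +ᵥ d ·ᵥ x
  ·ᵥ-distribʳ c d [] = refl
  ·ᵥ-distribʳ c d (a ∷ x) = cong₂ _∷_ (ℤ.*-distribʳ-+ a c d) (·ᵥ-distribʳ c d x)

  ·ᵥ-assoc : ∀ {n} c d (x : M n) → (c * d) ·ᵥ x ≡ c ·ᵥ (d ·ᵥ x)
  ·ᵥ-assoc c d x = trans (map-cong (ℤ.*-assoc c d) x) (map-∘ (c *_) (d *_) x)

  ·ᵥ-zeroˡ : ∀ {n} (x : M n) → 0ℤ ·ᵥ x ≡ 0ᵥ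
  ·ᵥ-zeroˡ [] = refl
  ·ᵥ-zeroˡ (a ∷ x) = cong (0ℤ ∷_) (·ᵥ-zeroˡ x)

  ·ᵥ-zeroʳ : ∀ {n} c → c ·ᵥ 0ᵥ {n} ≡ 0ᵥ
  ·ᵥ-zeroʳ {zero}  c = refl
  ·ᵥ-zeroʳ {suc n} c = cong₂ _∷_ (ℤ.*-zeroʳ c) (·ᵥ-zeroʳ c)

  ·ᵥ-identityˡ : ∀ {n} (x : M n) → 1ℤ ·ᵥ x ≡ x
  ·ᵥ-identityˡ [] = refl
  ·ᵥ-identityˡ (a ∷ x) = cong₂ _∷_ (ℤ.*-identityˡ a) (·ᵥ-identityˡ x)

  -1·ᵥ : ∀ {n} (x : M n) → -1ℤ ·ᵥ x ≡ -ᵥ x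
  -1·ᵥ = map-cong ℤ.-1*i≡-i

  x-[x-y]≡y : ∀ {n} (x y : M n) → x -ᵥ (x -ᵥ y) ≡ y
  x-[x-y]≡y [] [] = refl
  x-[x-y]≡y (a ∷ x) (b ∷ y) = cong₂ _∷_ (solve a b) (x-[x-y]≡y x y)
    where solve : ∀ a b → a - (a - b) ≡ b
          solve = solve-∀

  δ : ∀ {k} → Fin k → Fin k → ℤ
  δ zero    zero    = 1ℤ
  δ zero    (suc _) = 0ℤ
  δ (suc _) zero    = 0ℤ
  δ (suc i) (suc j) = δ i j

  δ-refl : ∀ {k} (i : Fin k) → δ i i ≡ 1ℤ
  δ-refl zero    = refl
  δ-refl (suc i) = δ-refl i

  δ-≢ : ∀ {k} {i j : Fin k} → i ≢ j → δ i j ≡ 0ℤ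
  δ-≢ {i = zero}  {zero}  i≢j = ⊥-elim (i≢j refl)
  δ-≢ {i = zero}  {suc j} _   = refl
  δ-≢ {i = suc i} {zero}  _   = refl
  δ-≢ {i = suc i} {suc j} i≢j = δ-≢ (i≢j ∘ cong suc)

  infixl 6 _[_]≔_
  _[_]≔_ : ∀ {A : Set} {k} → (Fin k → A) → Fin k → A → Fin k → A
  v [ j ]≔ a = updateAt v j (const a)

  []≔-updates : ∀ {A : Set} {k} (v : Fin k → A) (j : Fin k) {a : A} → (v [ j ]≔ a) j ≡ a
  []≔-updates v j = updateAt-updates j v

  []≔-minimal : ∀ {A : Set} {k} (v : Fin k → A) {i j : Fin k} {a : A} → i ≢ j → (v [ j ]≔ a) i ≡ v i
  []≔-minimal v {i} {j} = updateAt-minimal i j v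

  []≔-preserves : ∀ {A : Set} {k} (P : A → Set) {v : Fin k → A} {j : Fin k} {a : A} →
                  (∀ i → P (v i)) → P a → ∀ i → P ((v [ j ]≔ a) i)
  []≔-preserves P {v} {j} Pv Pa i with i Fin.≟ j
  ... | yes refl = subst P (sym ([]≔-updates v i)) Pa
  ... | no  i≢j  = subst P (sym ([]≔-minimal v i≢j)) (Pv i)

  ≗-head-tail : ∀ {A : Set} {m} {f g : Fin (suc m) → A} →
                f zero ≡ g zero → (∀ l → f (suc l) ≡ g (suc l)) → f ≗ g
  ≗-head-tail head _    zero    = head
  ≗-head-tail _    tail (suc l) = tail l

  module _ {n : ℕ} where

    lincomb-cong : ∀ {k} {c d : Fin k → ℤ} (B : Fin k → M n) → c ≗ d → lincomb c B ≡ lincomb d B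
    lincomb-cong {zero}  B c≗d = refl
    lincomb-cong {suc k} B c≗d =
      cong₂ _+ᵥ_ (cong (_·ᵥ B zero) (c≗d zero)) (lincomb-cong (B ∘ suc) (c≗d ∘ suc))

    lincomb-zero : ∀ {k} (B : Fin k → M n) → lincomb (const 0ℤ) B ≡ 0ᵥ
    lincomb-zero {zero}  B = refl
    lincomb-zero {suc k} B =
      trans (cong₂ _+ᵥ_ (·ᵥ-zeroˡ (B zero)) (lincomb-zero (B ∘ suc))) (+ᵥ-identityˡ 0ᵥ)

    lincomb-add : ∀ {k} (c d : Fin k → ℤ) (B : Fin k → M n) →
                  lincomb (λ i → c i + d i) B ≡ lincomb c B +ᵥ lincomb d B
    lincomb-add {zero}  c d B = sym (+ᵥ-identityˡ 0ᵥ)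
    lincomb-add {suc k} c d B =
      trans (cong₂ _+ᵥ_ (·ᵥ-distribʳ (c zero) (d zero) (B zero)) (lincomb-add (c ∘ suc) (d ∘ suc) (B ∘ suc)))
            (+ᵥ-interchange _ _ _ _)

    lincomb-scale : ∀ {k} s (c : Fin k → ℤ) (B : Fin k → M n) →
                    lincomb (λ i → s * c i) B ≡ s ·ᵥ lincomb c B
    lincomb-scale {zero}  s c B = sym (·ᵥ-zeroʳ s)
    lincomb-scale {suc k} s c B =
      trans (cong₂ _+ᵥ_ (·ᵥ-assoc s (c zero) (B zero)) (lincomb-scale s (c ∘ suc) (B ∘ suc)))
            (sym (·ᵥ-distribˡ s _ _))

    lincomb-neg : ∀ {k} (c : Fin k → ℤ) (B : Fin k → M n) → lincomb (λ i → - c i) B ≡ -ᵥ lincomb c B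
    lincomb-neg c B = begin
      lincomb (λ i → - c i) B      ≡⟨ lincomb-cong B (sym ∘ ℤ.-1*i≡-i ∘ c) ⟩
      lincomb (λ i → -1ℤ * c i) B  ≡⟨ lincomb-scale -1ℤ c B ⟩
      -1ℤ ·ᵥ lincomb c B           ≡⟨ -1·ᵥ _ ⟩
      -ᵥ lincomb c B               ∎
      where open ≡-Reasoning

    lincomb-sub : ∀ {k} (c d : Fin k → ℤ) (B : Fin k → M n) →
                  lincomb (λ i → c i - d i) B ≡ lincomb c B -ᵥ lincomb d B
    lincomb-sub c d B = trans (lincomb-add c (-_ ∘ d) B) (cong (lincomb c B +ᵥ_) (lincomb-neg d B))

    lincomb-δ : ∀ {k} (i : Fin k) (B : Fin k → M n) → lincomb (δ i) B ≡ B i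
    lincomb-δ zero    B =
      trans (cong₂ _+ᵥ_ (·ᵥ-identityˡ (B zero)) (lincomb-zero (B ∘ suc)))
            (trans (+ᵥ-comm _ _) (+ᵥ-identityˡ (B zero)))
    lincomb-δ (suc i) B =
      trans (cong₂ _+ᵥ_ (·ᵥ-zeroˡ (B zero)) (lincomb-δ i (B ∘ suc))) (+ᵥ-identityˡ (B (suc i)))

    lincomb-δ-δ : ∀ {k} (p q : Fin k) (B : Fin k → M n) → lincomb (λ i → δ p i - δ q i) B ≡ B p -ᵥ B q
    lincomb-δ-δ p q B = trans (lincomb-sub (δ p) (δ q) B) (cong₂ _-ᵥ_ (lincomb-δ p B) (lincomb-δ q B))

    lincomb-δ-δ-swap : ∀ {k} (p q : Fin k) (B : Fin k → M n) →
                       lincomb (λ i → δ q i - δ p i) B ≡ -ᵥ (B p -ᵥ B q)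
    lincomb-δ-δ-swap p q B = begin
      lincomb (λ i → δ q i - δ p i) B       ≡⟨ lincomb-cong B (λ i → solve (δ p i) (δ q i)) ⟩
      lincomb (λ i → - (δ p i - δ q i)) B   ≡⟨ lincomb-neg (λ i → δ p i - δ q i) B ⟩
      -ᵥ lincomb (λ i → δ p i - δ q i) B    ≡⟨ cong -ᵥ_ (lincomb-δ-δ p q B) ⟩
      -ᵥ (B p -ᵥ B q)                       ∎
      where
      open ≡-Reasoning
      solve : ∀ x y → y - x ≡ - (x - y)
      solve = solve-∀

    lincomb-δ-δ-δ : ∀ {k} (p q r : Fin k) (B : Fin k → M n) →
                    lincomb (λ i → δ p i - δ q i - δ r i) B ≡ B p -ᵥ B q -ᵥ B r
    lincomb-δ-δ-δ p q r B =
      trans (lincomb-sub (λ i → δ p i - δ q i) (δ r) B) (cong₂ _-ᵥ_ (lincomb-δ-δ p q B) (lincomb-δ r B))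

    lincomb-injective : ∀ {k} {B : Fin k → M n} → LinIndep B → ∀ c d → lincomb c B ≡ lincomb d B → c ≗ d
    lincomb-injective {B = B} indep c d eq i = ℤ.i-j≡0⇒i≡j (c i) (d i) (indep (λ i → c i - d i) c-d↦0 i)
      where
      c-d↦0 : lincomb (λ i → c i - d i) B ≡ 0ᵥ
      c-d↦0 = trans (lincomb-sub c d B) (trans (cong (_-ᵥ lincomb d B) eq) (+ᵥ-inverseʳ _))

  -- Exchanging one vector of a family

  exchanged-coords : ∀ {k} → Fin k → (w a : Fin k → ℤ) → Fin k → ℤ
  exchanged-coords j w a = (λ l → a l + a j * w l) [ j ]≔ - a j

  module _ {n : ℕ} where

    lincomb-[]≔ : ∀ {k} (c : Fin k → ℤ) (B : Fin k → M n) (j : Fin k) (y : M n) →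
                  lincomb c (B [ j ]≔ y) ≡ lincomb (c [ j ]≔ 0ℤ) B +ᵥ c j ·ᵥ y
    lincomb-[]≔ c B zero y = begin
      c zero ·ᵥ y +ᵥ L                   ≡⟨ +ᵥ-comm _ L ⟩
      L +ᵥ c zero ·ᵥ y                   ≡⟨ cong (_+ᵥ c zero ·ᵥ y) (+ᵥ-identityˡ L) ⟨
      0ᵥ +ᵥ L +ᵥ c zero ·ᵥ y             ≡⟨ cong (λ u → u +ᵥ L +ᵥ c zero ·ᵥ y) (·ᵥ-zeroˡ (B zero)) ⟨
      0ℤ ·ᵥ B zero +ᵥ L +ᵥ c zero ·ᵥ y   ∎
      where
      open ≡-Reasoning
      L = lincomb (c ∘ suc) (B ∘ suc)
    lincomb-[]≔ c B (suc j) y =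
      trans (cong (c zero ·ᵥ B zero +ᵥ_) (lincomb-[]≔ (c ∘ suc) (B ∘ suc) j y)) (sym (+ᵥ-assoc _ _ _))

    lincomb-exchange : ∀ {k} (c w : Fin k → ℤ) (B : Fin k → M n) (j : Fin k) →
                       lincomb c (B [ j ]≔ lincomb w B) ≡ lincomb (λ l → (c [ j ]≔ 0ℤ) l + c j * w l) B
    lincomb-exchange c w B j = begin
      lincomb c (B [ j ]≔ lincomb w B)                          ≡⟨ lincomb-[]≔ c B j _ ⟩
      lincomb (c [ j ]≔ 0ℤ) B +ᵥ c j ·ᵥ lincomb w B             ≡⟨ cong (_ +ᵥ_) (lincomb-scale (c j) w B) ⟨
      lincomb (c [ j ]≔ 0ℤ) B +ᵥ lincomb (λ l → c j * w l) B   ≡⟨ lincomb-add (c [ j ]≔ 0ℤ) _ B ⟨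
      lincomb (λ l → (c [ j ]≔ 0ℤ) l + c j * w l) B            ∎
      where open ≡-Reasoning

    exchange-linIndep : ∀ {k} {B : Fin k → M n} {w : Fin k → ℤ} {j : Fin k} →
                        LinIndep B → w j ≢ 0ℤ → LinIndep (B [ j ]≔ lincomb w B)
    exchange-linIndep {B = B} {w} {j} indep wj≢0 c c↦0 = c≡0
      where
      d≡0 : ∀ l → (c [ j ]≔ 0ℤ) l + c j * w l ≡ 0ℤ
      d≡0 = indep _ (trans (sym (lincomb-exchange c w B j)) c↦0)
      cj≡0 : c j ≡ 0ℤ
      cj≡0 with ℤ.i*j≡0⇒i≡0∨j≡0 (c j) (trans (sym (ℤ.+-identityˡ _))
                                           (trans (cong (_+ c j * w j) (sym ([]≔-updates c j))) (d≡0 j)))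
      ... | inj₁ cj≡0 = cj≡0
      ... | inj₂ wj≡0 = ⊥-elim (wj≢0 wj≡0)
      c≡0 : ∀ l → c l ≡ 0ℤ
      c≡0 l with l Fin.≟ j
      ... | yes refl = cj≡0
      ... | no  l≢j  = begin
        c l                             ≡⟨ ℤ.+-identityʳ (c l) ⟨
        c l + 0ℤ                        ≡⟨ cong (c l +_) (ℤ.*-zeroˡ (w l)) ⟨
        c l + 0ℤ * w l                  ≡⟨ cong₂ (λ u v → u + v * w l) ([]≔-minimal c l≢j) cj≡0 ⟨
        (c [ j ]≔ 0ℤ) l + c j * w l     ≡⟨ d≡0 l ⟩
        0ℤ                              ∎
        where open ≡-Reasoning

    lincomb-exchanged-coords : ∀ {k} (B : Fin k → M n) (j : Fin k) (w a : Fin k → ℤ) → w j ≡ -1ℤ →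
                               lincomb (exchanged-coords j w a) (B [ j ]≔ lincomb w B) ≡ lincomb a B
    lincomb-exchanged-coords B j w a wj≡-1 = trans (lincomb-exchange a′ w B j) (lincomb-cong B coefficient)
      where
      a′ = exchanged-coords j w a
      a′j≡-aj : a′ j ≡ - a j
      a′j≡-aj = []≔-updates _ j
      coefficient : ∀ l → (a′ [ j ]≔ 0ℤ) l + a′ j * w l ≡ a l
      coefficient l with l Fin.≟ j
      ... | yes refl = begin
        (a′ [ l ]≔ 0ℤ) l + a′ l * w l   ≡⟨ cong₂ (λ u v → u + v * w l) ([]≔-updates a′ l) a′j≡-aj ⟩
        0ℤ + - a l * w l               ≡⟨ cong (λ u → 0ℤ + - a l * u) wj≡-1 ⟩
        0ℤ + - a l * -1ℤ               ≡⟨ solve (a l) ⟩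
        a l                            ∎
        where
        open ≡-Reasoning
        solve : ∀ x → 0ℤ + - x * -1ℤ ≡ x
        solve = solve-∀
      ... | no  l≢j  = begin
        (a′ [ j ]≔ 0ℤ) l + a′ j * w l   ≡⟨ cong₂ (λ u v → u + v * w l)
                                              (trans ([]≔-minimal a′ l≢j) ([]≔-minimal _ l≢j)) a′j≡-aj ⟩
        a l + a j * w l + - a j * w l  ≡⟨ solve (a l) (a j) (w l) ⟩
        a l                            ∎
        where
        open ≡-Reasoning
        solve : ∀ x y z → x + y * z + - y * z ≡ x
        solve = solve-∀

  -- Bases drawn from S are unimodular for S

  Trit : ℤ → Set
  Trit z = z ≡ 0ℤ ⊎ z ≡ 1ℤ ⊎ z ≡ -1ℤ

  ¬Trit-2 : ¬ Trit -[1+ 1 ]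
  ¬Trit-2 (inj₂ (inj₁ ()))
  ¬Trit-2 (inj₂ (inj₂ ()))

  ¬Trit+2 : ¬ Trit +[1+ 1 ]
  ¬Trit+2 (inj₂ (inj₁ ()))
  ¬Trit+2 (inj₂ (inj₂ ()))

  ±1 : ∀ {x} → Trit x → x ≢ 0ℤ → x ≡ 1ℤ ⊎ x ≡ -1ℤ
  ±1 (inj₁ x≡0)  x≢0 = ⊥-elim (x≢0 x≡0)
  ±1 (inj₂ x≡±1) _   = x≡±1

  i*j≡1⇒i≡±1 : ∀ i j → i * j ≡ 1ℤ → i ≡ 1ℤ ⊎ i ≡ -1ℤ
  i*j≡1⇒i≡±1 i j ij≡1 with ℕₚ.m*n≡1⇒m≡1 ∣ i ∣ ∣ j ∣ (trans (sym (ℤ.abs-* i j)) (cong ∣_∣ ij≡1))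
  i*j≡1⇒i≡±1 +[1+ 0 ] j ij≡1 | refl = inj₁ refl
  i*j≡1⇒i≡±1 -[1+ 0 ] j ij≡1 | refl = inj₂ refl

  module _ {n : ℕ} (S : Subset n)
           (bases-generate : ∀ (v : Fin n → M n) → (∀ i → S (v i)) → LinIndep v → Generates v) where

    trit-coefficients : ∀ {B : Fin n → M n} → (∀ i → S (B i)) → LinIndep B →
                        ∀ b → S (lincomb b B) → ∀ k → Trit (b k)
    trit-coefficients {B} B⊆S indep b x∈S k with b k ℤ.≟ 0ℤ
    ... | yes bk≡0 = inj₁ bk≡0
    ... | no  bk≢0 = inj₂ (i*j≡1⇒i≡±1 (b k) (d k) bk*dk≡1)
      where
      Bk-in-B′ = bases-generate _ ([]≔-preserves S {B} {k} B⊆S x∈S) (exchange-linIndep indep bk≢0) (B k)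
      d = proj₁ Bk-in-B′
      coefficient-k : (d [ k ]≔ 0ℤ) k + d k * b k ≡ δ k k
      coefficient-k = lincomb-injective indep _ (δ k)
                        (trans (sym (lincomb-exchange d b B k)) (trans (proj₂ Bk-in-B′) (sym (lincomb-δ k B)))) k
      bk*dk≡1 : b k * d k ≡ 1ℤ
      bk*dk≡1 = begin
        b k * d k                      ≡⟨ ℤ.*-comm (b k) (d k) ⟩
        d k * b k                      ≡⟨ ℤ.+-identityˡ _ ⟨
        0ℤ + d k * b k                 ≡⟨ cong (_+ d k * b k) ([]≔-updates d k) ⟨
        (d [ k ]≔ 0ℤ) k + d k * b k    ≡⟨ coefficient-k ⟩
        δ k k                          ≡⟨ δ-refl k ⟩
        1ℤ                             ∎
        where open ≡-Reasoning

    -- In the family with B q replaced by B p - B q, the coefficient of B r - B p - B q on B p is -2.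
    difference⇒¬twisted : ∀ {B : Fin n → M n} → (∀ i → S (B i)) → LinIndep B → ∀ {p q r} →
                          p ≢ q → r ≢ p → r ≢ q → S (B p -ᵥ B q) → ¬ S (B r -ᵥ B p -ᵥ B q)
    difference⇒¬twisted {B} B⊆S indep {p} {q} {r} p≢q r≢p r≢q y∈S z∈S =
      ¬Trit-2 (subst Trit coefficient-p (trit-coefficients B′⊆S B′-indep _ z∈S′ p))
      where
      w ζ : Fin n → ℤ
      w k = δ p k - δ q k
      ζ k = δ r k - δ p k - δ q k
      wq≡-1 : w q ≡ -1ℤ
      wq≡-1 = cong₂ _-_ (δ-≢ p≢q) (δ-refl q)
      B′⊆S : ∀ i → S ((B [ q ]≔ lincomb w B) i)
      B′⊆S = []≔-preserves S {B} {q} B⊆S (subst S (sym (lincomb-δ-δ p q B)) y∈S)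
      B′-indep : LinIndep (B [ q ]≔ lincomb w B)
      B′-indep = exchange-linIndep {w = w} {q} indep (λ wq≡0 → -1≢0 (trans (sym wq≡-1) wq≡0))
        where -1≢0 : -1ℤ ≢ 0ℤ
              -1≢0 ()
      z∈S′ : S (lincomb (exchanged-coords q w ζ) (B [ q ]≔ lincomb w B))
      z∈S′ = subst S (sym (trans (lincomb-exchanged-coords B q w ζ wq≡-1) (lincomb-δ-δ-δ r p q B))) z∈S
      value : (δ r p - δ p p - δ q p) + (δ r q - δ p q - δ q q) * (δ p p - δ q p) ≡ -[1+ 1 ]
      value rewrite δ-refl p | δ-refl q | δ-≢ p≢q | δ-≢ (p≢q ∘ sym) | δ-≢ r≢p | δ-≢ r≢q = refl
      coefficient-p : exchanged-coords q w ζ p ≡ -[1+ 1 ]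
      coefficient-p = trans ([]≔-minimal _ p≢q) value

  -- Pivoting

  pivot-direction : ∀ {n} → Fin n → Fin (suc n) → ℤ
  pivot-direction i k = δ zero k - δ (suc i) k

  pivot : ∀ {n} → Fin n → (Fin (suc n) → M (suc n)) → Fin (suc n) → M (suc n)
  pivot i B = B [ suc i ]≔ lincomb (pivot-direction i) B

  pivot-coords : ∀ {n} → Fin n → (Fin (suc n) → ℤ) → Fin (suc n) → ℤ
  pivot-coords i = exchanged-coords (suc i) (pivot-direction i)

  pivot-direction-pivot : ∀ {n} (i : Fin n) → pivot-direction i (suc i) ≡ -1ℤ
  pivot-direction-pivot i = cong (_-_ 0ℤ) (δ-refl i)

  lincomb-pivot-coords : ∀ {n} (B : Fin (suc n) → M (suc n)) i a →
                         lincomb (pivot-coords i a) (pivot i B) ≡ lincomb a B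
  lincomb-pivot-coords B i a = lincomb-exchanged-coords B (suc i) (pivot-direction i) a (pivot-direction-pivot i)

  pivot-coords-zero : ∀ {n} (i : Fin n) a → pivot-coords i a zero ≡ a zero + a (suc i)
  pivot-coords-zero i a = cong (a zero +_) (ℤ.*-identityʳ (a (suc i)))

  pivot-coords-suc : ∀ {n} {i j : Fin n} a → j ≢ i → pivot-coords i a (suc j) ≡ a (suc j)
  pivot-coords-suc {i = i} {j} a j≢i = begin
    pivot-coords i a (suc j)                  ≡⟨ []≔-minimal (λ l → a l + a (suc i) * pivot-direction i l)
                                                             (j≢i ∘ suc-injective) ⟩
    a (suc j) + a (suc i) * (0ℤ - δ i j)      ≡⟨ cong (λ u → a (suc j) + a (suc i) * (0ℤ - u))
                                                       (δ-≢ (j≢i ∘ sym)) ⟩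
    a (suc j) + a (suc i) * 0ℤ                ≡⟨ cong (a (suc j) +_) (ℤ.*-zeroʳ (a (suc i))) ⟩
    a (suc j) + 0ℤ                            ≡⟨ ℤ.+-identityʳ _ ⟩
    a (suc j)                                 ∎
    where open ≡-Reasoning

  record Admissible {n} (S : Subset (suc n)) (B : Fin (suc n) → M (suc n)) : Set where
    field
      members     : ∀ k → S (B k)
      independent : LinIndep B
      differences : ∀ i → S (B zero -ᵥ B (suc i))

  open Admissible

  pivot-admissible : ∀ {n} {S : Subset (suc n)} {B} → Admissible S B → ∀ i → Admissible S (pivot i B)
  pivot-admissible {S = S} {B} adm i = record
    { members     = []≔-preserves S {B} {suc i} (members adm)
                                  (subst S (sym (lincomb-δ-δ zero (suc i) B)) (differences adm i))
    ; independent = exchange-linIndep {B = B} {pivot-direction i} {suc i} (independent adm) w≢0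
    ; differences = differences′
    }
    where
    w≢0 : pivot-direction i (suc i) ≢ 0ℤ
    w≢0 w≡0 with () ← trans (sym (pivot-direction-pivot i)) w≡0
    differences′ : ∀ j → S (pivot i B zero -ᵥ pivot i B (suc j))
    differences′ j with j Fin.≟ i
    ... | yes refl = subst S (sym (trans (cong (_-ᵥ_ (B zero)) ([]≔-updates B (suc j)))
                                         (trans (cong (_-ᵥ_ (B zero)) (lincomb-δ-δ zero (suc j) B))
                                                (x-[x-y]≡y (B zero) (B (suc j))))))
                             (members adm (suc j))
    ... | no  j≢i  = subst S (cong (_-ᵥ_ (B zero)) (sym ([]≔-minimal B (j≢i ∘ suc-injective)))) (differences adm j)

  module _ {n : ℕ} (S : Subset (suc n))
           (bases-generate : ∀ (v : Fin (suc n) → M (suc n)) → (∀ i → S (v i)) → LinIndep v → Generates v) where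

    trit-sum₁ : ∀ {B} → Admissible S B → ∀ a → S (lincomb a B) → ∀ i → Trit (a zero + a (suc i))
    trit-sum₁ {B} adm a x∈S i =
      subst Trit (pivot-coords-zero i a)
            (trit-coefficients S bases-generate (members adm′) (independent adm′) (pivot-coords i a) x∈S′ zero)
      where
      adm′ = pivot-admissible adm i
      x∈S′ = subst S (sym (lincomb-pivot-coords B i a)) x∈S

    trit-sum₂ : ∀ {B} → Admissible S B → ∀ a → S (lincomb a B) → ∀ {i j} → i ≢ j →
                Trit (a zero + a (suc i) + a (suc j))
    trit-sum₂ {B} adm a x∈S {i} {j} i≢j =
      subst Trit (cong₂ _+_ (pivot-coords-zero i a) (pivot-coords-suc a (i≢j ∘ sym)))
            (trit-sum₁ (pivot-admissible adm i) (pivot-coords i a) x∈S′ j)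
      where x∈S′ = subst S (sym (lincomb-pivot-coords B i a)) x∈S

    trit-sum₃ : ∀ {B} → Admissible S B → ∀ a → S (lincomb a B) → ∀ {i j l} → i ≢ j → i ≢ l → j ≢ l →
                Trit (a zero + a (suc i) + a (suc j) + a (suc l))
    trit-sum₃ {B} adm a x∈S {i} {j} {l} i≢j i≢l j≢l =
      subst Trit (cong₂ _+_ (cong₂ _+_ (pivot-coords-zero i a) (pivot-coords-suc a (i≢j ∘ sym)))
                            (pivot-coords-suc a (i≢l ∘ sym)))
            (trit-sum₂ (pivot-admissible adm i) (pivot-coords i a) x∈S′ j≢l)
      where x∈S′ = subst S (sym (lincomb-pivot-coords B i a)) x∈S

  data Support≤2 {m} (t : Fin m → ℤ) : Set where
    none : (∀ l → t l ≡ 0ℤ) → Support≤2 t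
    one  : ∀ i → t i ≢ 0ℤ → (∀ l → t l ≡ t i * δ i l) → Support≤2 t
    two  : ∀ i j → i <ᶠ j → t i ≢ 0ℤ → t j ≢ 0ℤ →
           (∀ l → t l ≡ t i * δ i l + t j * δ j l) → Support≤2 t

  module _ {m} (t : Fin m → ℤ) where

    vanishes-or-witness : {P : Fin m → Set} → Decidable P →
                          (∀ l → P l → t l ≡ 0ℤ) ⊎ ∃ λ l → P l × t l ≢ 0ℤ
    vanishes-or-witness P? with any? (λ l → P? l ×-dec ¬? (t l ℤ.≟ 0ℤ))
    ... | yes witness  = inj₂ witness
    ... | no  ¬witness = inj₁ vanishes
      where
      vanishes : ∀ l → _ → t l ≡ 0ℤ
      vanishes l Pl with t l ℤ.≟ 0ℤ
      ... | yes tl≡0 = tl≡0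
      ... | no  tl≢0 = ⊥-elim (¬witness (l , Pl , tl≢0))

    concentrated₁ : ∀ {i} → (∀ l → l ≢ i → t l ≡ 0ℤ) → ∀ l → t l ≡ t i * δ i l
    concentrated₁ {i} off-i l with l Fin.≟ i
    ... | yes refl = sym (trans (cong (t l *_) (δ-refl l)) (ℤ.*-identityʳ (t l)))
    ... | no  l≢i  = trans (off-i l l≢i) (sym (trans (cong (t i *_) (δ-≢ (l≢i ∘ sym))) (ℤ.*-zeroʳ (t i))))

    concentrated₂ : ∀ {i j} → i ≢ j → (∀ l → l ≢ i → l ≢ j → t l ≡ 0ℤ) →
                    ∀ l → t l ≡ t i * δ i l + t j * δ j l
    concentrated₂ {i} {j} i≢j off-ij l with l Fin.≟ i | l Fin.≟ j
    ... | yes refl | _        rewrite δ-refl l | δ-≢ (i≢j ∘ sym) = solve (t l) (t j)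
      where solve : ∀ x y → x ≡ x * 1ℤ + y * 0ℤ
            solve = solve-∀
    ... | no  l≢i  | yes refl rewrite δ-refl l | δ-≢ i≢j = solve (t i) (t l)
      where solve : ∀ x y → y ≡ x * 0ℤ + y * 1ℤ
            solve = solve-∀
    ... | no  l≢i  | no  l≢j  rewrite δ-≢ (l≢i ∘ sym) | δ-≢ (l≢j ∘ sym) =
      trans (off-ij l l≢i l≢j) (solve (t i) (t j))
      where solve : ∀ x y → 0ℤ ≡ x * 0ℤ + y * 0ℤ
            solve = solve-∀

    support≤2 : (∀ {i j l} → i ≢ j → i ≢ l → j ≢ l → t i ≢ 0ℤ → t j ≢ 0ℤ → t l ≢ 0ℤ → ⊥) →
                Support≤2 t
    support≤2 no-three with vanishes-or-witness (λ _ → yes tt)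
    ... | inj₁ vanishes = none (λ l → vanishes l tt)
    ... | inj₂ (i , _ , ti≢0) with vanishes-or-witness (λ l → ¬? (l Fin.≟ i))
    ...   | inj₁ off-i = one i ti≢0 (concentrated₁ off-i)
    ...   | inj₂ (j , j≢i , tj≢0) with vanishes-or-witness (λ l → ¬? (l Fin.≟ i) ×-dec ¬? (l Fin.≟ j))
    ...     | inj₂ (l , (l≢i , l≢j) , tl≢0) =
      ⊥-elim (no-three (j≢i ∘ sym) (l≢i ∘ sym) (l≢j ∘ sym) ti≢0 tj≢0 tl≢0)
    ...     | inj₁ off-ij with <-cmp i j
    ...       | tri< i<j _ _ = two i j i<j ti≢0 tj≢0 (concentrated₂ (j≢i ∘ sym) (λ l l≢i l≢j → off-ij l (l≢i , l≢j)))
    ...       | tri≈ _ i≡j _ = ⊥-elim (j≢i (sym i≡j))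
    ...       | tri> _ _ j<i = two j i j<i tj≢0 ti≢0 (concentrated₂ j≢i (λ l l≢j l≢i → off-ij l (l≢i , l≢j)))

  two-agree : ∀ {x y z : ℤ} → x ≡ 1ℤ ⊎ x ≡ -1ℤ → y ≡ 1ℤ ⊎ y ≡ -1ℤ → z ≡ 1ℤ ⊎ z ≡ -1ℤ →
              x ≡ y ⊎ x ≡ z ⊎ y ≡ z
  two-agree (inj₁ x≡1)  (inj₁ y≡1)  _           = inj₁ (trans x≡1 (sym y≡1))
  two-agree (inj₂ x≡-1) (inj₂ y≡-1) _           = inj₁ (trans x≡-1 (sym y≡-1))
  two-agree (inj₁ x≡1)  (inj₂ y≡-1) (inj₁ z≡1)  = inj₂ (inj₁ (trans x≡1 (sym z≡1)))
  two-agree (inj₁ x≡1)  (inj₂ y≡-1) (inj₂ z≡-1) = inj₂ (inj₂ (trans y≡-1 (sym z≡-1)))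
  two-agree (inj₂ x≡-1) (inj₁ y≡1)  (inj₁ z≡1)  = inj₂ (inj₂ (trans y≡1 (sym z≡1)))
  two-agree (inj₂ x≡-1) (inj₁ y≡1)  (inj₂ z≡-1) = inj₂ (inj₁ (trans x≡-1 (sym z≡-1)))

  injective-onto : ∀ {m k} → k ≤ m → (g : Fin m → Fin k) → Injective _≡_ _≡_ g → ∀ y → ∃ λ x → g x ≡ y
  injective-onto {k = suc k} k<m g g-injective y with any? (λ x → g x Fin.≟ y)
  ... | yes hit  = hit
  ... | no  miss = ⊥-elim (<⇒notInjective k<m punched-injective)
    where
    punched : Fin _ → Fin k
    punched x = punchOut (miss ∘ (x ,_) ∘ sym)
    punched-injective : Injective _≡_ _≡_ punched
    punched-injective {x} {x′} = g-injective ∘ punchOut-injective (miss ∘ (x ,_) ∘ sym) (miss ∘ (x′ ,_) ∘ sym)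

  -- Coordinates on e of the listed elements: with ê zero = 0 and ê (suc k) = e k, root p q is ê p - ê q,
  -- and twist± i j is ±(e zero - e (suc i) - e (suc j)), with the endpoints of ±(e (suc i) - e (suc j)).
  data Shape (n : ℕ) : Set where
    root   : (p q : Fin (suc (suc n))) → p ≢ q → Shape n
    twist⁺ : (i j : Fin n) → i <ᶠ j → Shape n
    twist⁻ : (i j : Fin n) → i <ᶠ j → Shape n

  δ̂ : ∀ {m} → Fin (suc m) → Fin m → ℤ
  δ̂ zero    _ = 0ℤ
  δ̂ (suc p)   = δ p

  shape-coords : ∀ {n} → Shape n → Fin (suc n) → ℤ
  shape-coords (root p q _)   k = δ̂ p k - δ̂ q k
  shape-coords (twist⁺ i j _) k = δ zero k - δ (suc i) k - δ (suc j) k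
  shape-coords (twist⁻ i j _) k = - (δ zero k - δ (suc i) k - δ (suc j) k)

  negate : ∀ {n} → Shape n → Shape n
  negate (root p q p≢q)   = root q p (p≢q ∘ sym)
  negate (twist⁺ i j i<j) = twist⁻ i j i<j
  negate (twist⁻ i j i<j) = twist⁺ i j i<j

  shape-coords-negate : ∀ {n} (s : Shape n) k → shape-coords (negate s) k ≡ - shape-coords s k
  shape-coords-negate (root p q _)   k = solve (δ̂ p k) (δ̂ q k)
    where solve : ∀ x y → y - x ≡ - (x - y)
          solve = solve-∀
  shape-coords-negate (twist⁺ i j _) k = refl
  shape-coords-negate (twist⁻ i j _) k = sym (ℤ.neg-involutive _)

  endpoints : ∀ {n} → Shape n → Fin (suc (suc n)) × Fin (suc (suc n))
  endpoints (root p q _)   = p , q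
  endpoints (twist⁺ i j _) = suc (suc i) , suc (suc j)
  endpoints (twist⁻ i j _) = suc (suc j) , suc (suc i)

  endpoints-distinct : ∀ {n} (s : Shape n) → proj₁ (endpoints s) ≢ proj₂ (endpoints s)
  endpoints-distinct (root p q p≢q)   = p≢q
  endpoints-distinct (twist⁺ i j i<j) = <⇒≢ i<j ∘ suc-injective ∘ suc-injective
  endpoints-distinct (twist⁻ i j i<j) = <⇒≢ i<j ∘ sym ∘ suc-injective ∘ suc-injective

  slot : ∀ {n} → Shape n → Fin (suc (suc n) ℕ.* suc n)
  slot s = combine (proj₁ (endpoints s)) (punchOut (endpoints-distinct s))

  combine-punchOut-injective : ∀ {m} {p q p′ q′ : Fin (suc m)} (p≢q : p ≢ q) (p′≢q′ : p′ ≢ q′) →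
                               combine p (punchOut p≢q) ≡ combine p′ (punchOut p′≢q′) → (p , q) ≡ (p′ , q′)
  combine-punchOut-injective {p = p} {q} {p′} {q′} p≢q p′≢q′ eq
    with combine-injective p (punchOut p≢q) p′ (punchOut p′≢q′) eq
  ... | refl , punchOut≡ = cong (_ ,_) (punchOut-injective p≢q p′≢q′ punchOut≡)

  slot-injective : ∀ {n} (s s′ : Shape n) → slot s ≡ slot s′ → endpoints s ≡ endpoints s′
  slot-injective s s′ = combine-punchOut-injective (endpoints-distinct s) (endpoints-distinct s′)

  -- Classification of the elements of S

  module Classification {n : ℕ} (S : Subset (suc n))
           (bases-generate : ∀ (v : Fin (suc n) → M (suc n)) → (∀ i → S (v i)) → LinIndep v → Generates v)
           (neg-closed : ∀ x → S x → S (-ᵥ x)) (0∉S : ¬ S 0ᵥ)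
           {e : Fin (suc n) → M (suc n)} (adm : Admissible S e) where

    Sᵉ : (Fin (suc n) → ℤ) → Set
    Sᵉ a = S (lincomb a e)

    Sᵉ-neg : ∀ a → Sᵉ a → Sᵉ (λ k → - a k)
    Sᵉ-neg a a∈S = subst S (sym (lincomb-neg a e)) (neg-closed _ a∈S)

    module _ (a : Fin (suc n) → ℤ) (a∈S : Sᵉ a) where

      trit : ∀ k → Trit (a k)
      trit = trit-coefficients S bases-generate (members adm) (independent adm) a a∈S

      module LeadingOne (a0≡1 : a zero ≡ 1ℤ) where

        tail-minus-one : ∀ {l} → a (suc l) ≢ 0ℤ → a (suc l) ≡ -1ℤ
        tail-minus-one {l} al≢0 with ±1 (trit (suc l)) al≢0
        ... | inj₂ al≡-1 = al≡-1
        ... | inj₁ al≡1  =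
          ⊥-elim (¬Trit+2 (subst Trit (cong₂ _+_ a0≡1 al≡1) (trit-sum₁ S bases-generate adm a a∈S l)))

        at-most-two-nonzero : ∀ {i j l} → i ≢ j → i ≢ l → j ≢ l →
                              a (suc i) ≢ 0ℤ → a (suc j) ≢ 0ℤ → a (suc l) ≢ 0ℤ → ⊥
        at-most-two-nonzero i≢j i≢l j≢l ai≢0 aj≢0 al≢0 =
          ¬Trit-2 (subst Trit (cong₂ _+_ (cong₂ _+_ (cong₂ _+_ a0≡1 (tail-minus-one ai≢0)) (tail-minus-one aj≢0))
                                         (tail-minus-one al≢0))
                              (trit-sum₃ S bases-generate adm a a∈S i≢j i≢l j≢l))

        shape : Σ (Shape n) λ s → a ≗ shape-coords s
        shape with support≤2 (a ∘ suc) at-most-two-nonzero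
        ... | none vanishes = root (suc zero) zero (λ ()) , ≗-head-tail a0≡1 vanishes
        ... | one i ai≢0 a≗ = root (suc zero) (suc (suc i)) (λ ()) , ≗-head-tail a0≡1 tail
          where
          solve : ∀ x → -1ℤ * x ≡ 0ℤ - x
          solve = solve-∀
          tail : ∀ l → a (suc l) ≡ 0ℤ - δ i l
          tail l = trans (a≗ l) (trans (cong (_* δ i l) (tail-minus-one ai≢0)) (solve (δ i l)))
        ... | two i j i<j ai≢0 aj≢0 a≗ = twist⁺ i j i<j , ≗-head-tail a0≡1 tail
          where
          solve : ∀ x y → -1ℤ * x + -1ℤ * y ≡ 0ℤ - x - y
          solve = solve-∀
          tail : ∀ l → a (suc l) ≡ 0ℤ - δ i l - δ j l
          tail l = trans (a≗ l) (trans (cong₂ (λ u v → u * δ i l + v * δ j l)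
                                              (tail-minus-one ai≢0) (tail-minus-one aj≢0))
                                       (solve (δ i l) (δ j l)))

      module LeadingZero (a0≡0 : a zero ≡ 0ℤ) where

        no-equal-pair : ∀ {i j} → i ≢ j → a (suc i) ≢ 0ℤ → a (suc i) ≡ a (suc j) → ⊥
        no-equal-pair {i} {j} i≢j ai≢0 ai≡aj with ±1 (trit (suc i)) ai≢0
        ... | inj₁ ai≡1  = ¬Trit+2 (subst Trit (cong₂ _+_ (cong₂ _+_ a0≡0 ai≡1) (trans (sym ai≡aj) ai≡1))
                                              (trit-sum₂ S bases-generate adm a a∈S i≢j))
        ... | inj₂ ai≡-1 = ¬Trit-2 (subst Trit (cong₂ _+_ (cong₂ _+_ a0≡0 ai≡-1) (trans (sym ai≡aj) ai≡-1))
                                              (trit-sum₂ S bases-generate adm a a∈S i≢j))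

        at-most-two-nonzero : ∀ {i j l} → i ≢ j → i ≢ l → j ≢ l →
                              a (suc i) ≢ 0ℤ → a (suc j) ≢ 0ℤ → a (suc l) ≢ 0ℤ → ⊥
        at-most-two-nonzero i≢j i≢l j≢l ai≢0 aj≢0 al≢0
          with two-agree (±1 (trit _) ai≢0) (±1 (trit _) aj≢0) (±1 (trit _) al≢0)
        ... | inj₁ ai≡aj        = no-equal-pair i≢j ai≢0 ai≡aj
        ... | inj₂ (inj₁ ai≡al) = no-equal-pair i≢l ai≢0 ai≡al
        ... | inj₂ (inj₂ aj≡al) = no-equal-pair j≢l aj≢0 aj≡al

        shape : Σ (Shape n) λ s → a ≗ shape-coords s
        shape with support≤2 (a ∘ suc) at-most-two-nonzero
        ... | none vanishes =
          ⊥-elim (0∉S (subst S (trans (lincomb-cong {c = a} {d = const 0ℤ} e (≗-head-tail a0≡0 vanishes))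
                                      (lincomb-zero e)) a∈S))
        ... | one i ai≢0 a≗ with ±1 (trit (suc i)) ai≢0
        ...   | inj₁ ai≡1 = root (suc (suc i)) zero (λ ()) , ≗-head-tail a0≡0 tail
          where
          solve : ∀ x → 1ℤ * x ≡ x - 0ℤ
          solve = solve-∀
          tail : ∀ l → a (suc l) ≡ δ i l - 0ℤ
          tail l = trans (a≗ l) (trans (cong (_* δ i l) ai≡1) (solve (δ i l)))
        ...   | inj₂ ai≡-1 = root zero (suc (suc i)) (λ ()) , ≗-head-tail a0≡0 tail
          where
          solve : ∀ x → -1ℤ * x ≡ 0ℤ - x
          solve = solve-∀
          tail : ∀ l → a (suc l) ≡ 0ℤ - δ i l
          tail l = trans (a≗ l) (trans (cong (_* δ i l) ai≡-1) (solve (δ i l)))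
        shape | two i j i<j ai≢0 aj≢0 a≗ with ±1 (trit (suc i)) ai≢0 | ±1 (trit (suc j)) aj≢0
        ... | inj₁ ai≡1  | inj₁ aj≡1  = ⊥-elim (no-equal-pair (<⇒≢ i<j) ai≢0 (trans ai≡1 (sym aj≡1)))
        ... | inj₂ ai≡-1 | inj₂ aj≡-1 = ⊥-elim (no-equal-pair (<⇒≢ i<j) ai≢0 (trans ai≡-1 (sym aj≡-1)))
        ... | inj₁ ai≡1  | inj₂ aj≡-1 =
          root (suc (suc i)) (suc (suc j)) (<⇒≢ i<j ∘ suc-injective ∘ suc-injective) , ≗-head-tail a0≡0 tail
          where
          solve : ∀ x y → 1ℤ * x + -1ℤ * y ≡ x - y
          solve = solve-∀
          tail : ∀ l → a (suc l) ≡ δ i l - δ j l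
          tail l = trans (a≗ l) (trans (cong₂ (λ u v → u * δ i l + v * δ j l) ai≡1 aj≡-1) (solve (δ i l) (δ j l)))
        ... | inj₂ ai≡-1 | inj₁ aj≡1 =
          root (suc (suc j)) (suc (suc i)) (<⇒≢ i<j ∘ sym ∘ suc-injective ∘ suc-injective) , ≗-head-tail a0≡0 tail
          where
          solve : ∀ x y → -1ℤ * x + 1ℤ * y ≡ y - x
          solve = solve-∀
          tail : ∀ l → a (suc l) ≡ δ j l - δ i l
          tail l = trans (a≗ l) (trans (cong₂ (λ u v → u * δ i l + v * δ j l) ai≡-1 aj≡1) (solve (δ i l) (δ j l)))

    classify : ∀ a → Sᵉ a → Σ (Shape n) λ s → a ≗ shape-coords s
    classify a a∈S with trit a a∈S zero
    ... | inj₁ a0≡0         = LeadingZero.shape a a∈S a0≡0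
    ... | inj₂ (inj₁ a0≡1)  = LeadingOne.shape a a∈S a0≡1
    ... | inj₂ (inj₂ a0≡-1) with LeadingOne.shape (λ k → - a k) (Sᵉ-neg a a∈S) (cong -_ a0≡-1)
    ...   | s , -a≗s = negate s , λ k → begin
      a k                        ≡⟨ ℤ.neg-involutive (a k) ⟨
      - - a k                    ≡⟨ cong -_ (-a≗s k) ⟩
      - shape-coords s k         ≡⟨ shape-coords-negate s k ⟨
      shape-coords (negate s) k  ∎
      where open ≡-Reasoning

    shape-of : ∀ x → S x → Σ (Shape n) λ s → x ≡ lincomb (shape-coords s) e
    shape-of x x∈S = s , trans (sym c-spec) (lincomb-cong e c≗s)
      where
      c = proj₁ (bases-generate e (members adm) (independent adm) x)
      c-spec = proj₂ (bases-generate e (members adm) (independent adm) x)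
      classified = classify c (subst S (sym c-spec) x∈S)
      s = proj₁ classified
      c≗s = proj₂ classified

    root⇒¬twisted : ∀ {i j} → i ≢ j → S (e (suc i) -ᵥ e (suc j)) → ¬ S (e zero -ᵥ e (suc i) -ᵥ e (suc j))
    root⇒¬twisted i≢j =
      difference⇒¬twisted S bases-generate (members adm) (independent adm) (i≢j ∘ suc-injective) (λ ()) (λ ())

    root⇒¬twist⁺ : ∀ {i j} (i<j : i <ᶠ j) {d} → Sᵉ (shape-coords (root (suc (suc i)) (suc (suc j)) d)) →
                   ¬ Sᵉ (shape-coords (twist⁺ i j i<j))
    root⇒¬twist⁺ {i} {j} i<j r∈S t∈S =
      root⇒¬twisted (<⇒≢ i<j) (subst S (lincomb-δ-δ (suc i) (suc j) e) r∈S)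
                              (subst S (lincomb-δ-δ-δ zero (suc i) (suc j) e) t∈S)

    root⇒¬twist⁻ : ∀ {i j} (i<j : i <ᶠ j) {d} → Sᵉ (shape-coords (root (suc (suc j)) (suc (suc i)) d)) →
                   ¬ Sᵉ (shape-coords (twist⁻ i j i<j))
    root⇒¬twist⁻ {i} {j} i<j r∈S t∈S =
      root⇒¬twisted (<⇒≢ i<j ∘ sym) (subst S (lincomb-δ-δ (suc j) (suc i) e) r∈S)
                    (subst S (trans (lincomb-cong e reorder) (lincomb-δ-δ-δ zero (suc j) (suc i) e))
                             (Sᵉ-neg (shape-coords (twist⁻ i j i<j)) t∈S))
      where
      solve : ∀ x y z → - - (x - y - z) ≡ x - z - y
      solve = solve-∀
      reorder : ∀ k → - - (δ zero k - δ (suc i) k - δ (suc j) k) ≡ δ zero k - δ (suc j) k - δ (suc i) k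
      reorder k = solve (δ zero k) (δ (suc i) k) (δ (suc j) k)

    same-endpoints⇒same-coords : ∀ s s′ → Sᵉ (shape-coords s) → Sᵉ (shape-coords s′) →
                                 endpoints s ≡ endpoints s′ → shape-coords s ≗ shape-coords s′
    same-endpoints⇒same-coords (root _ _ _)     (root _ _ _)     _ _ refl = λ _ → refl
    same-endpoints⇒same-coords (twist⁺ _ _ _)   (twist⁺ _ _ _)   _ _ refl = λ _ → refl
    same-endpoints⇒same-coords (twist⁻ _ _ _)   (twist⁻ _ _ _)   _ _ refl = λ _ → refl
    same-endpoints⇒same-coords (root _ _ d)     (twist⁺ _ _ i<j) r t refl = ⊥-elim (root⇒¬twist⁺ i<j {d} r t)
    same-endpoints⇒same-coords (twist⁺ _ _ i<j) (root _ _ d)     t r refl = ⊥-elim (root⇒¬twist⁺ i<j {d} r t)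
    same-endpoints⇒same-coords (root _ _ d)     (twist⁻ _ _ i<j) r t refl = ⊥-elim (root⇒¬twist⁻ i<j {d} r t)
    same-endpoints⇒same-coords (twist⁻ _ _ i<j) (root _ _ d)     t r refl = ⊥-elim (root⇒¬twist⁻ i<j {d} r t)
    same-endpoints⇒same-coords (twist⁺ _ _ i<j) (twist⁻ _ _ j<i) _ _ refl = ⊥-elim (<-asym i<j j<i)
    same-endpoints⇒same-coords (twist⁻ _ _ i<j) (twist⁺ _ _ j<i) _ _ refl = ⊥-elim (<-asym i<j j<i)

    Listed : M (suc n) → Set
    Listed x = (∃[ i ] (x ≡ e i ⊎ x ≡ -ᵥ e i))
             ⊎ (∃[ i ] (0 < toℕ i × (x ≡ e zero -ᵥ e i ⊎ x ≡ -ᵥ (e zero -ᵥ e i))))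
             ⊎ (∃[ i ] ∃[ j ] (0 < toℕ i × i <ᶠ j ×
                  ((x ≡ e i -ᵥ e j ⊎ x ≡ -ᵥ (e i -ᵥ e j))
                   ⊎ (x ≡ e zero -ᵥ e i -ᵥ e j ⊎ x ≡ -ᵥ (e zero -ᵥ e i -ᵥ e j)))))

    shape-listed : ∀ s → Listed (lincomb (shape-coords s) e)
    shape-listed (root zero zero p≢q) = ⊥-elim (p≢q refl)
    shape-listed (root zero (suc k) _) =
      inj₁ (k , inj₂ (trans (lincomb-cong e (ℤ.+-identityˡ ∘ -_ ∘ δ k))
                            (trans (lincomb-neg (δ k) e) (cong -ᵥ_ (lincomb-δ k e)))))
    shape-listed (root (suc k) zero _) =
      inj₁ (k , inj₁ (trans (lincomb-cong e (ℤ.+-identityʳ ∘ δ k)) (lincomb-δ k e)))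
    shape-listed (root (suc zero) (suc zero) p≢q) = ⊥-elim (p≢q refl)
    shape-listed (root (suc zero) (suc (suc i)) _) =
      inj₂ (inj₁ (suc i , s≤s z≤n , inj₁ (lincomb-δ-δ zero (suc i) e)))
    shape-listed (root (suc (suc i)) (suc zero) _) =
      inj₂ (inj₁ (suc i , s≤s z≤n , inj₂ (lincomb-δ-δ-swap zero (suc i) e)))
    shape-listed (root (suc (suc i)) (suc (suc j)) p≢q) with <-cmp i j
    ... | tri< i<j _ _  =
      inj₂ (inj₂ (suc i , suc j , s≤s z≤n , s≤s i<j , inj₁ (inj₁ (lincomb-δ-δ (suc i) (suc j) e))))
    ... | tri≈ _ refl _ = ⊥-elim (p≢q refl)
    ... | tri> _ _ j<i  =
      inj₂ (inj₂ (suc j , suc i , s≤s z≤n , s≤s j<i , inj₁ (inj₂ (lincomb-δ-δ-swap (suc j) (suc i) e))))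
    shape-listed (twist⁺ i j i<j) =
      inj₂ (inj₂ (suc i , suc j , s≤s z≤n , s≤s i<j , inj₂ (inj₁ (lincomb-δ-δ-δ zero (suc i) (suc j) e))))
    shape-listed (twist⁻ i j i<j) =
      inj₂ (inj₂ (suc i , suc j , s≤s z≤n , s≤s i<j ,
                  inj₂ (inj₂ (trans (lincomb-neg (shape-coords (twist⁺ i j i<j)) e)
                                    (cong -ᵥ_ (lincomb-δ-δ-δ zero (suc i) (suc j) e))))))

    listed : ∀ x → S x → Listed x
    listed x x∈S = subst Listed (sym (proj₂ (shape-of x x∈S))) (shape-listed (proj₁ (shape-of x x∈S)))

    Dichotomy : Fin (suc n) → Fin (suc n) → Set
    Dichotomy i j = ((S (e i -ᵥ e j) × S (-ᵥ (e i -ᵥ e j)))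
                       × ¬ (S (e zero -ᵥ e i -ᵥ e j) × S (-ᵥ (e zero -ᵥ e i -ᵥ e j))))
                    ⊎ (¬ (S (e i -ᵥ e j) × S (-ᵥ (e i -ᵥ e j)))
                       × (S (e zero -ᵥ e i -ᵥ e j) × S (-ᵥ (e zero -ᵥ e i -ᵥ e j))))

    module Counting {N : ℕ} (N-large : suc (suc n) ℕ.* suc n ≤ N) (f : Fin N → M (suc n))
                    (f-injective : Injective _≡_ _≡_ f) (f∈S : ∀ k → S (f k)) where

      shapeᶠ : Fin N → Shape n
      shapeᶠ k = proj₁ (shape-of (f k) (f∈S k))

      shapeᶠ-∈S : ∀ k → Sᵉ (shape-coords (shapeᶠ k))
      shapeᶠ-∈S k = subst S (proj₂ (shape-of (f k) (f∈S k))) (f∈S k)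

      slot-shapeᶠ-injective : Injective _≡_ _≡_ (slot ∘ shapeᶠ)
      slot-shapeᶠ-injective {k} {k′} eq = f-injective (begin
        f k                                   ≡⟨ proj₂ (shape-of (f k) (f∈S k)) ⟩
        lincomb (shape-coords (shapeᶠ k)) e   ≡⟨ lincomb-cong e same-coords ⟩
        lincomb (shape-coords (shapeᶠ k′)) e  ≡⟨ proj₂ (shape-of (f k′) (f∈S k′)) ⟨
        f k′                                  ∎)
        where
        open ≡-Reasoning
        same-coords = same-endpoints⇒same-coords (shapeᶠ k) (shapeᶠ k′) (shapeᶠ-∈S k) (shapeᶠ-∈S k′)
                                                 (slot-injective (shapeᶠ k) (shapeᶠ k′) eq)

      dichotomy : ∀ {i j} → i <ᶠ j → Dichotomy (suc i) (suc j)
      dichotomy {i} {j} i<j = from-shape (shapeᶠ k) (shapeᶠ-∈S k) (slot-injective (shapeᶠ k) root-ij slot≡)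
        where
        root-ij = root (suc (suc i)) (suc (suc j)) (<⇒≢ i<j ∘ suc-injective ∘ suc-injective)
        occupied = injective-onto N-large (slot ∘ shapeᶠ) slot-shapeᶠ-injective (slot root-ij)
        k = proj₁ occupied
        slot≡ = proj₂ occupied
        from-shape : ∀ s → Sᵉ (shape-coords s) → endpoints s ≡ (suc (suc i) , suc (suc j)) →
                     Dichotomy (suc i) (suc j)
        from-shape (root _ _ _) r∈S refl =
          inj₁ ((y∈S , neg-closed _ y∈S) , root⇒¬twisted (<⇒≢ i<j) y∈S ∘ proj₁)
          where y∈S = subst S (lincomb-δ-δ (suc i) (suc j) e) r∈S
        from-shape (twist⁺ _ _ _) t∈S refl =
          inj₂ ((λ y → root⇒¬twisted (<⇒≢ i<j) (proj₁ y) z∈S) , z∈S , neg-closed _ z∈S)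
          where z∈S = subst S (lincomb-δ-δ-δ zero (suc i) (suc j) e) t∈S
        from-shape (twist⁻ _ _ j<i) _ refl = ⊥-elim (<-asym i<j j<i)

open import Data.Nat using (_*_; _+_)
import Data.Nat.Properties as ℕₚ

lemma5 : (n : ℕ) (h : 2 ≤ n) (S : Subset n) →
         ¬ S 0ᵥ →
         (∀ x → S x → S (-ᵥ x)) →
         HasFullRank S →
         CardGE S (n * (n + 1)) →
         (∀ (v : Fin n → M n) → (∀ i → S (v i)) → LinIndep v → Generates v) →
         (e : Fin n → M n) →
         (∀ i → S (e i)) →
         LinIndep e →
         (∀ (i : Fin n) → 0 < toℕ i → S (e (first h) -ᵥ e i)) →
         (∀ x → S x →
            (∃[ i ] (x ≡ e i ⊎ x ≡ -ᵥ e i))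
            ⊎ (∃[ i ] (0 < toℕ i × (x ≡ e (first h) -ᵥ e i ⊎ x ≡ -ᵥ (e (first h) -ᵥ e i))))
            ⊎ (∃[ i ] ∃[ j ] (0 < toℕ i × i <ᶠ j ×
                 ((x ≡ e i -ᵥ e j ⊎ x ≡ -ᵥ (e i -ᵥ e j))
                  ⊎ (x ≡ e (first h) -ᵥ e i -ᵥ e j ⊎ x ≡ -ᵥ (e (first h) -ᵥ e i -ᵥ e j))))))
         × (∀ (i j : Fin n) → 0 < toℕ i → i <ᶠ j →
              ((S (e i -ᵥ e j) × S (-ᵥ (e i -ᵥ e j)))
                 × ¬ (S (e (first h) -ᵥ e i -ᵥ e j) × S (-ᵥ (e (first h) -ᵥ e i -ᵥ e j))))
              ⊎ (¬ (S (e i -ᵥ e j) × S (-ᵥ (e i -ᵥ e j)))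
                 × (S (e (first h) -ᵥ e i -ᵥ e j) × S (-ᵥ (e (first h) -ᵥ e i -ᵥ e j)))))
lemma5 (suc (suc m)) (s≤s (s≤s z≤n)) S 0∉S neg-closed _ (f , f-injective , f∈S) bases-generate
       e e∈S e-independent e-differences = listed , pairs
  where
  n = suc (suc m)
  adm : Admissible S e
  adm = record { members = e∈S ; independent = e-independent ; differences = λ i → e-differences (suc i) (s≤s z≤n) }
  open Classification S bases-generate neg-closed 0∉S adm
  N-large : suc n * n ≤ n * (n + 1)
  N-large = ℕₚ.≤-reflexive (trans (ℕₚ.*-comm (suc n) n) (cong (n *_) (ℕₚ.+-comm 1 n)))
  open Counting N-large f f-injective f∈S
  pairs : ∀ (i j : Fin n) → 0 < toℕ i → i <ᶠ j → Dichotomy i j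
  pairs (suc i) (suc j) _ (s≤s i<j) = dichotomy i<j
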